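{- Let $m>4$ be an integer, $r>0$ a real number, $n\in[2^m,2^{m+1})$ an integer, and let $1=a_0<a_1<\cdots<a_{\lfloor m+r\rfloor}=n$ be an addition chain of length $\lfloor m+r\rfloor$ leading to $n$, with step-type counts $A,B,C,D$. Then $$B+C+D\le \frac{r}{1-\log_2\gamma}.$$
   Context: An addition chain of length $k$ is a sequence of integers $1=a_0<a_1<\cdots<a_k$ such that for each $1\le j\le k$ there are indices $0\le i,s<j$ with $a_j=a_s+a_i$. Let $\gamma=(1+\sqrt5)/2$ and, for an integer $m\ge 2$, $\delta=1/\log m$ (natural logarithm). For an addition chain $a_0<\cdots<a_{\lfloor m+r\rfloor}$, the indices $j\in\{1,\dots,\lfloor m+r\rfloor\}$ are partitioned into $\mathcal A=\{j: a_j=2a_{j-1}\}$, $\mathcal B=\{j:\gamma a_{j-1}\le a_j<2a_{j-1}\}$, $\mathcal C=\{j:(1+\delta)a_{j-1}\le a_j<\gamma a_{j-1}\}$, $\mathcal D=\{j: a_j<(1+\delta)a_{j-1}\}$; their cardinalities are $A,B,C,D$. $\log_2$ is the base-2 logarithm.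
   Formalization: The parameter r ranges over the positive rationals instead of the positive reals. -}

module Defs where

open import Data.Nat as ℕ using (ℕ; zero; suc)
open import Data.Nat.Properties using (_≟_)
open import Data.Integer as ℤ using (ℤ; +_)
open import Data.Rational as ℚ using (ℚ; 0ℚ; 1ℚ; ↥_; ↧ₙ_)
open import Data.List using (List; length; filter; upTo)
open import Data.Product using (Σ; ∃; _×_; _,_)
open import Data.Sum using (_⊎_)
open import Relation.Nullary using (¬_)
open import Relation.Nullary.Decidable using (¬?)
open import Relation.Binary.PropositionalEquality using (_≡_)

-- Addition chains, given as a function a : ℕ → ℕ of which only the
-- values a 0 , … , a k matter.

record IsAdditionChain (a : ℕ → ℕ) (k : ℕ) : Set where
  field
    start      : a 0 ≡ 1
    increasing : ∀ j → j ℕ.< k → a j ℕ.< a (suc j)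
    sums       : ∀ j → 1 ℕ.≤ j → j ℕ.≤ k →
                 ∃ λ i → ∃ λ s → i ℕ.< j × s ℕ.< j × a j ≡ a s ℕ.+ a i

-- Set 𝒜 = { j ∈ {1..k} : a_j = 2 a_{j-1} }.  Since 𝒜,ℬ,𝒞,𝒟 partition
-- {1..k}, B + C + D is the number of indices j ∈ {1..k} with
-- a_j ≠ 2 a_{j-1}.  (Index j = suc i for i ∈ upTo k = [0..k-1].)
BCD : (ℕ → ℕ) → ℕ → ℕ
BCD a k = length (filter (λ i → ¬? (a (suc i) ≟ 2 ℕ.* a i)) (upTo k))

-- The ordered field ℚ(√5): ⟨ x , y ⟩ stands for x + y √5 with x y : ℚ.

record ℚ√5 : Set where
  constructor ⟨_,_⟩
  field
    re : ℚ
    im : ℚ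
open ℚ√5 public

_⊕_ : ℚ√5 → ℚ√5 → ℚ√5
⟨ a , b ⟩ ⊕ ⟨ c , d ⟩ = ⟨ a ℚ.+ c , b ℚ.+ d ⟩

_⊗_ : ℚ√5 → ℚ√5 → ℚ√5
⟨ a , b ⟩ ⊗ ⟨ c , d ⟩ =
  ⟨ a ℚ.* c ℚ.+ (+ 5 ℚ./ 1) ℚ.* (b ℚ.* d) , a ℚ.* d ℚ.+ b ℚ.* c ⟩

⊖_ : ℚ√5 → ℚ√5
⊖ ⟨ a , b ⟩ = ⟨ ℚ.- a , ℚ.- b ⟩

fromℚ : ℚ → ℚ√5
fromℚ q = ⟨ q , 0ℚ ⟩

_^5_ : ℚ√5 → ℕ → ℚ√5
x ^5 zero  = fromℚ 1ℚ
x ^5 suc n = x ⊗ (x ^5 n)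

-- x + y √5 ≥ 0 (as a real number)
Nonneg : ℚ√5 → Set
Nonneg ⟨ a , b ⟩ =
    (0ℚ ℚ.≤ a × 0ℚ ℚ.≤ b)
  ⊎ (0ℚ ℚ.≤ a × b ℚ.< 0ℚ × (+ 5 ℚ./ 1) ℚ.* (b ℚ.* b) ℚ.≤ a ℚ.* a)
  ⊎ (a ℚ.< 0ℚ × 0ℚ ℚ.< b × a ℚ.* a ℚ.≤ (+ 5 ℚ./ 1) ℚ.* (b ℚ.* b))

_≤√5_ : ℚ√5 → ℚ√5 → Set
x ≤√5 y = Nonneg (y ⊕ (⊖ x))

γ : ℚ√5
γ = ⟨ + 1 ℚ./ 2 , + 1 ℚ./ 2 ⟩

-- For c : ℕ and r = p/q : ℚ with p > 0 (numerator p, denominator q > 0):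
--   c ≤ r / (1 - log₂ γ)
--   ⇔ c q (1 - log₂ γ) ≤ p          (1 - log₂ γ > 0, q > 0)
--   ⇔ 2^(c q) ≤ 2^p · γ^(c q)       (apply the increasing map 2^(·))
-- which is a comparison in ℚ(√5).
BoundedByGolden : ℕ → ℚ → Set
BoundedByGolden c r =
  fromℚ (+ (2 ℕ.^ (c ℕ.* ↧ₙ r)) ℚ./ 1)
    ≤√5 (fromℚ (+ (2 ℕ.^ ℤ.∣ ↥ r ∣) ℚ./ 1) ⊗ (γ ^5 (c ℕ.* ↧ₙ r)))

{-# OPTIONS --safe #-}
module Submission where

-- Work in ℕ[γ] = { x + y γ }.  Along the chain, a_j is at most the product of a
-- factor 2 for every doubling step and a factor γ for every other step: a
-- non-doubling step has a_j ≤ a_(j-1) + a_(j-2), and the companion invariant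
-- a_j + a_(j-1) ≤ γ · (bound) propagates because γ² = γ + 1 and 3 ≤ 2γ.  With
-- N = B + C + D this gives 2^N 2^m ≤ 2^N n ≤ 2^L γ^N, where L ≤ m + r; raising to
-- the power q, where r = p/q, and cancelling 2^(m q) leaves 2^(N q) ≤ 2^p γ^(N q).
-- Inequalities in ℕ[γ] are certified in ℕ: α ≼ β if γ^n α ≤ γ^n β coefficientwise
-- for some n.  Such a certificate is a real inequality because the sign of w + z γ
-- (w, z ∈ ℤ) is determined by the signs of w, z and of its norm, multiplication by
-- γ preserves negativity, and coefficientwise nonnegative elements are not negative.

module GoldenIntegers where

  open import Data.Nat using (ℕ; zero; suc; _+_; _*_; _^_; _≤_; NonZero)
  open import Data.Nat.Properties
  open import Data.Nat.Tactic.RingSolver using (solve-∀)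
  open import Data.Product using (_×_; _,_; ∃-syntax)
  open import Relation.Binary.Bundles using (Preorder)
  import Relation.Binary.Reasoning.Preorder
  open import Relation.Binary.PropositionalEquality

  infix  4 _≤ᶜ_ _≼_
  infixl 6 _⊞_
  infixl 7 _⊠_
  infix  8 γ·_ γ^_·_ 2^_·γ^_

  -- (x , y) stands for x + y γ, where γ² = γ + 1.
  ℕ[γ] : Set
  ℕ[γ] = ℕ × ℕ

  ι : ℕ → ℕ[γ]
  ι c = c , 0

  _⊞_ : ℕ[γ] → ℕ[γ] → ℕ[γ]
  (x , y) ⊞ (u , v) = x + u , y + v

  _⊠_ : ℕ[γ] → ℕ[γ] → ℕ[γ]
  (x , y) ⊠ (u , v) = x * u + y * v , x * v + y * u + y * v

  γ·_ : ℕ[γ] → ℕ[γ]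
  γ· (x , y) = y , x + y

  γ^_·_ : ℕ → ℕ[γ] → ℕ[γ]
  γ^ zero  · α = α
  γ^ suc n · α = γ· γ^ n · α

  2^_·γ^_ : ℕ → ℕ → ℕ[γ]
  2^ e ·γ^ k = γ^ k · ι (2 ^ e)

  ι-⊠-scales : ∀ c x y → ι c ⊠ (x , y) ≡ (c * x , c * y)
  ι-⊠-scales c x y = cong₂ _,_ (+-identityʳ (c * x)) (trans (+-identityʳ _) (+-identityʳ (c * y)))

  ι-⊠ : ∀ c d → ι c ⊠ ι d ≡ ι (c * d)
  ι-⊠ c d = trans (ι-⊠-scales c d 0) (cong (c * d ,_) (*-zeroʳ c))

  γ·-⊞ : ∀ α β → γ· (α ⊞ β) ≡ γ· α ⊞ γ· β
  γ·-⊞ (x , y) (u , v) = cong (y + v ,_) (eq x y u v)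
    where
    eq : ∀ x y u v → x + u + (y + v) ≡ x + y + (u + v)
    eq = solve-∀

  γ·α⊞α≡γ·γ·α : ∀ α → γ· α ⊞ α ≡ γ· γ· α
  γ·α⊞α≡γ·γ·α (x , y) = cong₂ _,_ (+-comm y x) (eq x y)
    where
    eq : ∀ x y → x + y + y ≡ y + (x + y)
    eq = solve-∀

  γ·-⊠ˡ : ∀ α β → γ· α ⊠ β ≡ γ· (α ⊠ β)
  γ·-⊠ˡ (x , y) (u , v) = cong₂ _,_ (eq₁ x y u v) (eq₂ x y u v)
    where
    eq₁ : ∀ x y u v → y * u + (x + y) * v ≡ x * v + y * u + y * v
    eq₁ = solve-∀
    eq₂ : ∀ x y u v → y * v + (x + y) * u + (x + y) * v ≡ x * u + y * v + (x * v + y * u + y * v)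
    eq₂ = solve-∀

  γ·-⊠ʳ : ∀ α β → α ⊠ γ· β ≡ γ· (α ⊠ β)
  γ·-⊠ʳ (x , y) (u , v) = cong₂ _,_ (eq₁ x y u v) (eq₂ x y u v)
    where
    eq₁ : ∀ x y u v → x * v + y * (u + v) ≡ x * v + y * u + y * v
    eq₁ = solve-∀
    eq₂ : ∀ x y u v → x * (u + v) + y * v + y * (u + v) ≡ x * u + y * v + (x * v + y * u + y * v)
    eq₂ = solve-∀

  γ^-⊞ : ∀ n α β → γ^ n · (α ⊞ β) ≡ γ^ n · α ⊞ γ^ n · β
  γ^-⊞ zero    α β = refl
  γ^-⊞ (suc n) α β = trans (cong γ·_ (γ^-⊞ n α β)) (γ·-⊞ (γ^ n · α) (γ^ n · β))

  γ^-⊠ : ∀ n k α β → γ^ n · α ⊠ γ^ k · β ≡ γ^ (n + k) · (α ⊠ β)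
  γ^-⊠ zero    zero    α β = refl
  γ^-⊠ zero    (suc k) α β = trans (γ·-⊠ʳ α (γ^ k · β)) (cong γ·_ (γ^-⊠ zero k α β))
  γ^-⊠ (suc n) k       α β = trans (γ·-⊠ˡ (γ^ n · α) (γ^ k · β)) (cong γ·_ (γ^-⊠ n k α β))

  monomial-⊠ : ∀ e k f l → 2^ e ·γ^ k ⊠ 2^ f ·γ^ l ≡ 2^ (e + f) ·γ^ (k + l)
  monomial-⊠ e k f l = begin
    γ^ k · ι (2 ^ e) ⊠ γ^ l · ι (2 ^ f)   ≡⟨ γ^-⊠ k l (ι (2 ^ e)) (ι (2 ^ f)) ⟩
    γ^ (k + l) · (ι (2 ^ e) ⊠ ι (2 ^ f))  ≡⟨ cong (γ^ (k + l) ·_) (ι-⊠ (2 ^ e) (2 ^ f)) ⟩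
    γ^ (k + l) · ι (2 ^ e * 2 ^ f)        ≡⟨ cong (λ c → γ^ (k + l) · ι c) (^-distribˡ-+-* 2 e f) ⟨
    γ^ (k + l) · ι (2 ^ (e + f))          ∎
    where open ≡-Reasoning

  _≤ᶜ_ : ℕ[γ] → ℕ[γ] → Set
  (x , y) ≤ᶜ (u , v) = x ≤ u × y ≤ v

  ≤ᶜ-refl : ∀ {α} → α ≤ᶜ α
  ≤ᶜ-refl = ≤-refl , ≤-refl

  ≤ᶜ-trans : ∀ {α β δ} → α ≤ᶜ β → β ≤ᶜ δ → α ≤ᶜ δ
  ≤ᶜ-trans (p , q) (r , s) = ≤-trans p r , ≤-trans q s

  ⊞-mono-≤ᶜ : ∀ {α β δ ε} → α ≤ᶜ β → δ ≤ᶜ ε → α ⊞ δ ≤ᶜ β ⊞ ε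
  ⊞-mono-≤ᶜ (p , q) (r , s) = +-mono-≤ p r , +-mono-≤ q s

  ⊠-mono-≤ᶜ : ∀ {α β δ ε} → α ≤ᶜ β → δ ≤ᶜ ε → α ⊠ δ ≤ᶜ β ⊠ ε
  ⊠-mono-≤ᶜ (p , q) (r , s) =
    +-mono-≤ (*-mono-≤ p r) (*-mono-≤ q s) ,
    +-mono-≤ (+-mono-≤ (*-mono-≤ p s) (*-mono-≤ q r)) (*-mono-≤ q s)

  γ·-mono-≤ᶜ : ∀ {α β} → α ≤ᶜ β → γ· α ≤ᶜ γ· β
  γ·-mono-≤ᶜ (p , q) = q , +-mono-≤ p q

  γ^-mono-≤ᶜ : ∀ n {α β} → α ≤ᶜ β → γ^ n · α ≤ᶜ γ^ n · β
  γ^-mono-≤ᶜ zero    α≤β = α≤β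
  γ^-mono-≤ᶜ (suc n) α≤β = γ·-mono-≤ᶜ (γ^-mono-≤ᶜ n α≤β)

  -- Since γ > 0, α ≼ β implies α ≤ β as real numbers.
  _≼_ : ℕ[γ] → ℕ[γ] → Set
  α ≼ β = ∃[ n ] γ^ n · α ≤ᶜ γ^ n · β

  ≤ᶜ⇒≼ : ∀ {α β} → α ≤ᶜ β → α ≼ β
  ≤ᶜ⇒≼ α≤β = 0 , α≤β

  ≼-reflexive : ∀ {α β} → α ≡ β → α ≼ β
  ≼-reflexive refl = ≤ᶜ⇒≼ ≤ᶜ-refl

  ≼-align : ∀ {α β δ ε} → α ≼ β → δ ≼ ε →
            ∃[ n ] γ^ n · α ≤ᶜ γ^ n · β × γ^ n · δ ≤ᶜ γ^ n · ε
  ≼-align {α} {β} {δ} {ε} (m , p) (n , q) =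
    n + m , shift n p , subst (λ k → γ^ k · δ ≤ᶜ γ^ k · ε) (+-comm m n) (shift m q)
    where
    shift : ∀ k {l α β} → γ^ l · α ≤ᶜ γ^ l · β → γ^ (k + l) · α ≤ᶜ γ^ (k + l) · β
    shift zero    p = p
    shift (suc k) p = γ·-mono-≤ᶜ (shift k p)

  ≼-trans : ∀ {α β δ} → α ≼ β → β ≼ δ → α ≼ δ
  ≼-trans α≼β β≼δ with ≼-align α≼β β≼δ
  ... | n , p , q = n , ≤ᶜ-trans p q

  ≼-preorder : Preorder _ _ _
  ≼-preorder = record
    { Carrier    = ℕ[γ]
    ; _≈_        = _≡_
    ; _≲_        = _≼_
    ; isPreorder = record
      { isEquivalence = isEquivalence
      ; reflexive     = ≼-reflexive
      ; trans         = ≼-trans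
      }
    }

  ⊞-mono-≼ : ∀ {α β δ ε} → α ≼ β → δ ≼ ε → α ⊞ δ ≼ β ⊞ ε
  ⊞-mono-≼ {α} {β} {δ} {ε} α≼β δ≼ε with ≼-align α≼β δ≼ε
  ... | n , p , q = n , subst₂ _≤ᶜ_ (sym (γ^-⊞ n α δ)) (sym (γ^-⊞ n β ε)) (⊞-mono-≤ᶜ p q)

  ⊠-mono-≼ : ∀ {α β δ ε} → α ≼ β → δ ≼ ε → α ⊠ δ ≼ β ⊠ ε
  ⊠-mono-≼ {α} {β} {δ} {ε} α≼β δ≼ε with ≼-align α≼β δ≼ε
  ... | n , p , q = n + n , subst₂ _≤ᶜ_ (γ^-⊠ n n α δ) (γ^-⊠ n n β ε) (⊠-mono-≤ᶜ p q)

  ⊠-monoʳ-≼ : ∀ α {β δ} → β ≼ δ → α ⊠ β ≼ α ⊠ δ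
  ⊠-monoʳ-≼ α = ⊠-mono-≼ (≼-reflexive {α} refl)

  ι⊠-cancelˡ-≤ᶜ : ∀ c .{{_ : NonZero c}} {α β} → ι c ⊠ α ≤ᶜ ι c ⊠ β → α ≤ᶜ β
  ι⊠-cancelˡ-≤ᶜ c {x , y} {u , v} p with subst₂ _≤ᶜ_ (ι-⊠-scales c x y) (ι-⊠-scales c u v) p
  ... | cx≤cu , cy≤cv = *-cancelˡ-≤ c cx≤cu , *-cancelˡ-≤ c cy≤cv

  ι⊠-cancelˡ-≼ : ∀ c .{{_ : NonZero c}} {α β} → ι c ⊠ α ≼ ι c ⊠ β → α ≼ β
  ι⊠-cancelˡ-≼ c {α} {β} (n , p) =
    n , ι⊠-cancelˡ-≤ᶜ c (subst₂ _≤ᶜ_ (sym (γ^-⊠ 0 n (ι c) α)) (sym (γ^-⊠ 0 n (ι c) β)) p)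

  module ≼-Reasoning = Relation.Binary.Reasoning.Preorder ≼-preorder

  monomial-mono-≼ : ∀ k {e f} → e ≤ f → 2^ e ·γ^ k ≼ 2^ f ·γ^ k
  monomial-mono-≼ k e≤f = ≤ᶜ⇒≼ (γ^-mono-≤ᶜ k (^-monoʳ-≤ 2 e≤f , ≤-refl))

  monomial-pow-≼ : ∀ q {e k f l} → 2^ e ·γ^ k ≼ 2^ f ·γ^ l →
                   2^ (e * q) ·γ^ (k * q) ≼ 2^ (f * q) ·γ^ (l * q)
  monomial-pow-≼ zero {e} {k} {f} {l} _
    rewrite *-zeroʳ e | *-zeroʳ k | *-zeroʳ f | *-zeroʳ l = ≼-reflexive refl
  monomial-pow-≼ (suc q) {e} {k} {f} {l} h = begin
    2^ (e * suc q) ·γ^ (k * suc q)       ≡⟨ cong₂ 2^_·γ^_ (*-suc e q) (*-suc k q) ⟩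
    2^ (e + e * q) ·γ^ (k + k * q)       ≡⟨ monomial-⊠ e k (e * q) (k * q) ⟨
    2^ e ·γ^ k ⊠ 2^ (e * q) ·γ^ (k * q)  ≲⟨ ⊠-mono-≼ h (monomial-pow-≼ q {e} {k} {f} {l} h) ⟩
    2^ f ·γ^ l ⊠ 2^ (f * q) ·γ^ (l * q)  ≡⟨ monomial-⊠ f l (f * q) (l * q) ⟩
    2^ (f + f * q) ·γ^ (l + l * q)       ≡⟨ cong₂ 2^_·γ^_ (*-suc f q) (*-suc l q) ⟨
    2^ (f * suc q) ·γ^ (l * suc q)       ∎
    where open ≼-Reasoning

  monomial-cancelˡ-≼ : ∀ d {e k f l} → 2^ (d + e) ·γ^ k ≼ 2^ (d + f) ·γ^ l → 2^ e ·γ^ k ≼ 2^ f ·γ^ l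
  monomial-cancelˡ-≼ d {e} {k} {f} {l} h = ι⊠-cancelˡ-≼ (2 ^ d) {{m^n≢0 2 d}} (begin
    ι (2 ^ d) ⊠ 2^ e ·γ^ k  ≡⟨ monomial-⊠ d 0 e k ⟩
    2^ (d + e) ·γ^ k        ≲⟨ h ⟩
    2^ (d + f) ·γ^ l        ≡⟨ monomial-⊠ d 0 f l ⟨
    ι (2 ^ d) ⊠ 2^ f ·γ^ l  ∎)
    where open ≼-Reasoning

module AdditionChains where

  open import Defs using (IsAdditionChain; BCD)
  open GoldenIntegers
  open import Data.Nat using (ℕ; zero; suc; _+_; _*_; _^_; _≤_; z≤n; s≤s; s≤s⁻¹)
  open import Data.Nat.Properties
  open import Data.Nat.Tactic.RingSolver using (solve-∀)
  open import Data.List using ([]; _∷_; _++_; length; filter; upTo)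
  open import Function using (_∘_)
  open import Data.List.Properties using (applyUpTo-∷ʳ; filter-++; length-++; filter-accept; filter-reject)
  open import Data.Product using (_×_; _,_; proj₁; ∃-syntax)
  open import Data.Sum using (inj₁; inj₂)
  open import Relation.Nullary using (yes; no; ¬_; contradiction)
  open import Relation.Nullary.Decidable using (¬?)
  open import Relation.Binary.PropositionalEquality

  majorant : (ℕ → ℕ) → ℕ → ℕ[γ]
  majorant a zero = ι 1
  majorant a (suc j) with a (suc j) ≟ 2 * a j
  ... | yes _ = ι 2 ⊠ majorant a j
  ... | no  _ = γ· majorant a j

  BCD-suc : ∀ a j → BCD a (suc j) ≡ BCD a j + length (filter (λ i → ¬? (a (suc i) ≟ 2 * a i)) (j ∷ []))
  BCD-suc a j = begin
    length (filter P? (upTo (suc j)))               ≡⟨ cong (length ∘ filter P?) (applyUpTo-∷ʳ (λ i → i) j) ⟨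
    length (filter P? (upTo j ++ j ∷ []))           ≡⟨ cong length (filter-++ P? (upTo j) (j ∷ [])) ⟩
    length (filter P? (upTo j) ++ filter P? (j ∷ [])) ≡⟨ length-++ (filter P? (upTo j)) ⟩
    BCD a j + length (filter P? (j ∷ []))          ∎
    where
    open ≡-Reasoning
    P? = λ i → ¬? (a (suc i) ≟ 2 * a i)

  BCD-suc-doubling : ∀ a j → a (suc j) ≡ 2 * a j → BCD a (suc j) ≡ BCD a j
  BCD-suc-doubling a j dbl = trans (BCD-suc a j)
    (trans (cong (λ l → BCD a j + length l) (filter-reject (λ i → ¬? (a (suc i) ≟ 2 * a i)) (λ ¬dbl → ¬dbl dbl)))
           (+-identityʳ (BCD a j)))

  BCD-suc-non-doubling : ∀ a j → ¬ a (suc j) ≡ 2 * a j → BCD a (suc j) ≡ suc (BCD a j)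
  BCD-suc-non-doubling a j ¬dbl = trans (BCD-suc a j)
    (trans (cong (λ l → BCD a j + length l) (filter-accept (λ i → ¬? (a (suc i) ≟ 2 * a i)) ¬dbl))
           (+-comm (BCD a j) 1))

  majorant-monomial : ∀ a j → ∃[ d ] d + BCD a j ≡ j × majorant a j ≡ 2^ d ·γ^ BCD a j
  majorant-monomial a zero = 0 , refl , refl
  majorant-monomial a (suc j) with a (suc j) ≟ 2 * a j | majorant-monomial a j
  ... | yes dbl | d , d+N≡j , M≡ rewrite BCD-suc-doubling a j dbl =
    suc d , cong suc d+N≡j , trans (cong (ι 2 ⊠_) M≡) (monomial-⊠ 1 0 d (BCD a j))
  ... | no ¬dbl | d , d+N≡j , M≡ rewrite BCD-suc-non-doubling a j ¬dbl =
    d , trans (+-suc d (BCD a j)) (cong suc d+N≡j) , cong γ·_ M≡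

  ι3≼γ·ι2 : ι 3 ≼ γ· ι 2
  ι3≼γ·ι2 = 3 , n≤1+n 3 , ≤-refl

  doubling-step-≼ : ∀ {x M} → ι x ≼ M → ι (2 * x) ≼ ι 2 ⊠ M × ι (2 * x + x) ≼ γ· (ι 2 ⊠ M)
  doubling-step-≼ {x} {M} x≼M = (begin
    ι (2 * x)      ≡⟨ ι-⊠ 2 x ⟨
    ι 2 ⊠ ι x      ≲⟨ ⊠-monoʳ-≼ (ι 2) x≼M ⟩
    ι 2 ⊠ M        ∎) , (begin
    ι (2 * x + x)  ≡⟨ cong ι (triple x) ⟩
    ι (3 * x)      ≡⟨ ι-⊠ 3 x ⟨
    ι 3 ⊠ ι x      ≲⟨ ⊠-mono-≼ ι3≼γ·ι2 x≼M ⟩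
    γ· ι 2 ⊠ M     ≡⟨ γ·-⊠ˡ (ι 2) M ⟩
    γ· (ι 2 ⊠ M)   ∎)
    where
    open ≼-Reasoning
    triple : ∀ x → 2 * x + x ≡ 3 * x
    triple = solve-∀

  non-doubling-step-≼ : ∀ {z x y M} → z ≤ x + y → ι x ≼ M → ι (x + y) ≼ γ· M →
                        ι z ≼ γ· M × ι (z + x) ≼ γ· γ· M
  non-doubling-step-≼ {z} {x} {y} {M} z≤x+y x≼M x+y≼γM = z≼γM , (begin
    ι (z + x)   ≡⟨⟩
    ι z ⊞ ι x   ≲⟨ ⊞-mono-≼ z≼γM x≼M ⟩
    γ· M ⊞ M    ≡⟨ γ·α⊞α≡γ·γ·α M ⟩
    γ· γ· M     ∎)
    where
    open ≼-Reasoning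
    z≼γM : ι z ≼ γ· M
    z≼γM = ≼-trans (≤ᶜ⇒≼ (z≤x+y , ≤-refl)) x+y≼γM

  module _ {a : ℕ → ℕ} {k : ℕ} (chain : IsAdditionChain a k) where

    open IsAdditionChain chain
    open ≼-Reasoning hiding (start)

    chain-mono : ∀ {i j} → i ≤ j → j ≤ k → a i ≤ a j
    chain-mono {j = zero}  z≤n   _     = ≤-refl
    chain-mono {j = suc j} i≤1+j 1+j≤k with m≤n⇒m<n∨m≡n i≤1+j
    ... | inj₂ refl      = ≤-refl
    ... | inj₁ (s≤s i≤j) = ≤-trans (chain-mono i≤j (<⇒≤ 1+j≤k)) (<⇒≤ (increasing j 1+j≤k))

    first-step-doubles : 1 ≤ k → a 1 ≡ 2 * a 0
    first-step-doubles 1≤k with sums 1 ≤-refl 1≤k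
    ... | i , s , i<1 , s<1 , a₁≡ rewrite n<1⇒n≡0 i<1 | n<1⇒n≡0 s<1 =
      trans a₁≡ (cong (a 0 +_) (sym (+-identityʳ (a 0))))

    non-doubling-step-≤ : ∀ i → 2 + i ≤ k → ¬ a (2 + i) ≡ 2 * a (1 + i) → a (2 + i) ≤ a (1 + i) + a i
    non-doubling-step-≤ i 2+i≤k ¬dbl with sums (2 + i) (s≤s z≤n) 2+i≤k
    ... | t , s , t<2+i , s<2+i , a≡ with m<1+n⇒m<n∨m≡n s<2+i | m<1+n⇒m<n∨m≡n t<2+i
    ...   | inj₂ refl | inj₂ refl =
      contradiction (trans a≡ (cong (a s +_) (sym (+-identityʳ (a s))))) ¬dbl
    ...   | inj₂ refl | inj₁ (s≤s t≤i) =
      ≤-trans (≤-reflexive a≡) (+-monoʳ-≤ (a s) (chain-mono t≤i (<⇒≤ (<⇒≤ 2+i≤k))))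
    ...   | inj₁ (s≤s s≤i) | _ =
      ≤-trans (≤-reflexive (trans a≡ (+-comm (a s) (a t))))
              (+-mono-≤ (chain-mono (s≤s⁻¹ t<2+i) (<⇒≤ 2+i≤k)) (chain-mono s≤i (<⇒≤ (<⇒≤ 2+i≤k))))

    majorant-invariant : ∀ i → 1 + i ≤ k →
      ι (a (1 + i)) ≼ majorant a (1 + i) × ι (a (1 + i) + a i) ≼ γ· majorant a (1 + i)
    majorant-invariant zero 1≤k with a 1 ≟ 2 * a 0
    ... | no ¬dbl = contradiction (first-step-doubles 1≤k) ¬dbl
    ... | yes dbl rewrite trans dbl (cong (2 *_) start) | start = doubling-step-≼ {1} (≼-reflexive refl)
    majorant-invariant (suc i) 2+i≤k with a (2 + i) ≟ 2 * a (1 + i) | majorant-invariant i (<⇒≤ 2+i≤k)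
    ... | yes dbl | x≼M , _      rewrite dbl = doubling-step-≼ x≼M
    ... | no ¬dbl | x≼M , x+y≼γM = non-doubling-step-≼ (non-doubling-step-≤ i 2+i≤k ¬dbl) x≼M x+y≼γM

    element-≼-majorant : ∀ j → j ≤ k → ι (a j) ≼ majorant a j
    element-≼-majorant zero    _     = ≼-reflexive (cong ι start)
    element-≼-majorant (suc i) 1+i≤k = proj₁ (majorant-invariant i 1+i≤k)

    addition-chain-bound : ι (2 ^ BCD a k) ⊠ ι (a k) ≼ 2^ k ·γ^ BCD a k
    addition-chain-bound with majorant-monomial a k
    ... | d , d+N≡k , M≡ = begin
      ι (2 ^ N) ⊠ ι (a k)          ≲⟨ ⊠-monoʳ-≼ (ι (2 ^ N)) (element-≼-majorant k ≤-refl) ⟩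
      ι (2 ^ N) ⊠ majorant a k     ≡⟨ cong (ι (2 ^ N) ⊠_) M≡ ⟩
      2^ N ·γ^ 0 ⊠ 2^ d ·γ^ N      ≡⟨ monomial-⊠ N 0 d N ⟩
      2^ (N + d) ·γ^ N             ≡⟨ cong (2^_·γ^ N) (trans (+-comm N d) d+N≡k) ⟩
      2^ k ·γ^ N                   ∎
      where
      N = BCD a k

module Sign where

  open GoldenIntegers using (ℕ[γ]; γ·_; γ^_·_; _≤ᶜ_; _≼_)
  open import Data.Nat as ℕ using (ℕ; zero; suc)
  open import Data.Integer using (ℤ; +_; 0ℤ; _+_; _*_; _-_; -_; _≤_; _<_; +≤+; nonNegative; positive)
  open import Data.Integer.Properties
  open import Data.Integer.Tactic.RingSolver using (solve-∀)
  open import Data.Product using (_×_; _,_)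
  open import Data.Sum using (_⊎_; inj₁; inj₂)
  open import Relation.Nullary using (yes; no; ¬_; contradiction)
  open import Relation.Binary.PropositionalEquality

  infix 6 _⊟_
  infix 8 γ·ᶻ_

  ℤ[γ] : Set
  ℤ[γ] = ℤ × ℤ

  γ·ᶻ_ : ℤ[γ] → ℤ[γ]
  γ·ᶻ (w , z) = z , w + z

  _⊟_ : ℕ[γ] → ℕ[γ] → ℤ[γ]
  (x , y) ⊟ (u , v) = + x - + u , + y - + v

  γ·-⊟ : ∀ α β → γ·ᶻ (β ⊟ α) ≡ γ· β ⊟ γ· α
  γ·-⊟ (u , v) (x , y) = cong (+ y - + v ,_) (begin
    + x - + u + (+ y - + v)  ≡⟨ eq (+ x) (+ u) (+ y) (+ v) ⟩
    + x + + y - (+ u + + v)  ≡⟨ cong₂ _-_ (pos-+ x y) (pos-+ u v) ⟨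
    + (x ℕ.+ y) - + (u ℕ.+ v) ∎)
    where
    open ≡-Reasoning
    eq : ∀ x u y v → x - u + (y - v) ≡ x + y - (u + v)
    eq = solve-∀

  -- (w + z γ)(w + z γ̄), where γ̄ = 1 - γ = -1/γ.
  norm : ℤ → ℤ → ℤ
  norm w z = w * w + w * z - z * z

  norm-γ· : ∀ w z → norm z (w + z) ≡ - norm w z
  norm-γ· = eq
    where
    eq : ∀ w z → z * z + z * (w + z) - (w + z) * (w + z) ≡ - (w * w + w * z - z * z)
    eq = solve-∀

  -- w + z γ < 0.  If w and z have opposite signs, then w + z γ̄ has the sign of w,
  -- so the sign of w + z γ is read off the norm.
  data Negative : ℤ[γ] → Set where
    neg-nonpos : ∀ {w z} → w < 0ℤ → z ≤ 0ℤ → Negative (w , z)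
    nonpos-neg : ∀ {w z} → w ≤ 0ℤ → z < 0ℤ → Negative (w , z)
    neg-pos    : ∀ {w z} → w < 0ℤ → 0ℤ < z → 0ℤ < norm w z → Negative (w , z)
    pos-neg    : ∀ {w z} → 0ℤ < w → z < 0ℤ → norm w z < 0ℤ → Negative (w , z)

  norm<0 : ∀ {w z} → w < 0ℤ → 0ℤ < z → 0ℤ ≤ w + z → norm w z < 0ℤ
  norm<0 {w} {z} w<0 0<z 0≤w+z = subst (_< 0ℤ) (sym (eq w z))
    (+-mono-≤-< (*-monoʳ-≤-nonNeg (w + z) {{nonNegative 0≤w+z}} (<⇒≤ w<0))
                (neg-mono-< (*-monoʳ-<-pos z {{positive 0<z}} 0<z)))
    where
    eq : ∀ w z → w * w + w * z - z * z ≡ w * (w + z) + - (z * z)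
    eq = solve-∀

  γ·ᶻ-negative : ∀ {α} → Negative α → Negative (γ·ᶻ α)
  γ·ᶻ-negative (neg-nonpos w<0 z≤0) = nonpos-neg z≤0 (+-mono-<-≤ w<0 z≤0)
  γ·ᶻ-negative (nonpos-neg w≤0 z<0) = neg-nonpos z<0 (+-mono-≤ w≤0 (<⇒≤ z<0))
  γ·ᶻ-negative {w , z} (neg-pos w<0 0<z 0<N) with w + z <? 0ℤ
  ... | yes w+z<0 = pos-neg 0<z w+z<0 (subst (_< 0ℤ) (sym (norm-γ· w z)) (neg-mono-< 0<N))
  ... | no  w+z≮0 = contradiction 0<N (<-asym (norm<0 w<0 0<z (≮⇒≥ w+z≮0)))
  γ·ᶻ-negative {w , z} (pos-neg 0<w z<0 N<0) with 0ℤ <? w + z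
  ... | yes 0<w+z = neg-pos z<0 0<w+z (subst (0ℤ <_) (sym (norm-γ· w z)) (neg-mono-< N<0))
  ... | no  0≮w+z = neg-nonpos z<0 (≮⇒≥ 0≮w+z)

  nonneg⇒¬negative : ∀ {w z} → 0ℤ ≤ w → 0ℤ ≤ z → ¬ Negative (w , z)
  nonneg⇒¬negative 0≤w 0≤z (neg-nonpos w<0 _)   = <⇒≱ w<0 0≤w
  nonneg⇒¬negative 0≤w 0≤z (nonpos-neg _ z<0)   = <⇒≱ z<0 0≤z
  nonneg⇒¬negative 0≤w 0≤z (neg-pos w<0 _ _)    = <⇒≱ w<0 0≤w
  nonneg⇒¬negative 0≤w 0≤z (pos-neg _ z<0 _)    = <⇒≱ z<0 0≤z

  γ^-⊟-negative : ∀ n {α β} → Negative (β ⊟ α) → Negative (γ^ n · β ⊟ γ^ n · α)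
  γ^-⊟-negative zero    neg = neg
  γ^-⊟-negative (suc n) {α} {β} neg =
    subst Negative (γ·-⊟ (γ^ n · α) (γ^ n · β)) (γ·ᶻ-negative (γ^-⊟-negative n neg))

  ≤ᶜ⇒¬negative : ∀ {α β} → α ≤ᶜ β → ¬ Negative (β ⊟ α)
  ≤ᶜ⇒¬negative (x≤u , y≤v) = nonneg⇒¬negative (i≤j⇒0≤j-i (+≤+ x≤u)) (i≤j⇒0≤j-i (+≤+ y≤v))

  ≼⇒¬negative : ∀ {α β} → α ≼ β → ¬ Negative (β ⊟ α)
  ≼⇒¬negative (n , p) neg = ≤ᶜ⇒¬negative p (γ^-⊟-negative n neg)

  -- (2 w + z) + z √5 = 2 (w + z γ) is nonnegative, in the case z ≥ 0.
  Nonneg√5 : ℤ[γ] → Set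
  Nonneg√5 (w , z) =
    0ℤ ≤ + 2 * w + z ⊎ (+ 2 * w + z < 0ℤ × 0ℤ < z × (+ 2 * w + z) * (+ 2 * w + z) ≤ + 5 * (z * z))

  ¬negative⇒nonneg√5 : ∀ {w z} → 0ℤ ≤ z → ¬ Negative (w , z) → Nonneg√5 (w , z)
  ¬negative⇒nonneg√5 {w} {z} 0≤z ¬neg with 0ℤ ≤? + 2 * w + z
  ... | yes 0≤W = inj₁ 0≤W
  ... | no  0≰W = inj₂ (≰⇒> 0≰W , 0<z , W²≤5z²)
    where
    w<0 : w < 0ℤ
    w<0 = ≰⇒> (λ 0≤w → 0≰W (+-mono-≤ (*-monoˡ-≤-nonNeg (+ 2) 0≤w) 0≤z))
    0<z : 0ℤ < z
    0<z = ≤∧≢⇒< 0≤z (λ 0≡z → ¬neg (neg-nonpos w<0 (≤-reflexive (sym 0≡z))))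
    N≤0 : norm w z ≤ 0ℤ
    N≤0 = ≮⇒≥ (λ 0<N → ¬neg (neg-pos w<0 0<z 0<N))
    W²≡ : ∀ w z → (+ 2 * w + z) * (+ 2 * w + z) ≡ + 4 * (w * w + w * z - z * z) + + 5 * (z * z)
    W²≡ = solve-∀
    W²≤5z² : (+ 2 * w + z) * (+ 2 * w + z) ≤ + 5 * (z * z)
    W²≤5z² = begin
      (+ 2 * w + z) * (+ 2 * w + z)      ≡⟨ W²≡ w z ⟩
      + 4 * norm w z + + 5 * (z * z)     ≤⟨ +-monoˡ-≤ (+ 5 * (z * z)) (*-monoˡ-≤-nonNeg (+ 4) N≤0) ⟩
      0ℤ + + 5 * (z * z)                 ≡⟨ +-identityˡ (+ 5 * (z * z)) ⟩
      + 5 * (z * z)                      ∎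
      where open ≤-Reasoning

module IntegerCast where

  open import Data.Nat as ℕ using (suc)
  open import Data.Integer as ℤ using (ℤ; +_; -[1+_])
  import Data.Integer.Properties as ℤ
  open import Data.Integer.DivMod using ([n/d]*d≤n)
  open import Data.Integer.Tactic.RingSolver using (solve-∀)
  open import Data.Nat.Coprimality as Coprimality using (1-coprimeTo)
  open import Data.Rational using (ℚ; mkℚ; _/_; _+_; _*_; -_; _-_; _≤_; _<_; *≤*; *<*; 0ℚ; toℚᵘ; floor; ↥_; ↧_; ↧ₙ_)
  open import Data.Rational.Properties
  open import Data.Rational.Solver using (module +-*-Solver)
  import Data.Rational.Unnormalised as ℚᵘ
  import Data.Rational.Unnormalised.Properties as ℚᵘ
  open import Relation.Binary.PropositionalEquality

  fromℤ : ℤ → ℚ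
  fromℤ i = i / 1

  fromℤ≡mkℚ : ∀ i → fromℤ i ≡ mkℚ i 0 (Coprimality.sym (1-coprimeTo ℤ.∣ i ∣))
  fromℤ≡mkℚ (+ n)    = normalize-coprime (Coprimality.sym (1-coprimeTo n))
  fromℤ≡mkℚ -[1+ n ] = cong -_ (normalize-coprime (Coprimality.sym (1-coprimeTo (suc n))))

  toℚᵘ-fromℤ : ∀ i → toℚᵘ (fromℤ i) ℚᵘ.≃ ℚᵘ.mkℚᵘ i 0
  toℚᵘ-fromℤ i = toℚᵘ-fromℚᵘ (ℚᵘ.mkℚᵘ i 0)

  fromℤ-homo-+ : ∀ i j → fromℤ (i ℤ.+ j) ≡ fromℤ i + fromℤ j
  fromℤ-homo-+ i j = toℚᵘ-injective (begin
    toℚᵘ (fromℤ (i ℤ.+ j))                 ≈⟨ toℚᵘ-fromℤ (i ℤ.+ j) ⟩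
    ℚᵘ.mkℚᵘ (i ℤ.+ j) 0                    ≈⟨ ℚᵘ.*≡* (eq i j) ⟩
    ℚᵘ.mkℚᵘ i 0 ℚᵘ.+ ℚᵘ.mkℚᵘ j 0          ≈⟨ ℚᵘ.+-cong (toℚᵘ-fromℤ i) (toℚᵘ-fromℤ j) ⟨
    toℚᵘ (fromℤ i) ℚᵘ.+ toℚᵘ (fromℤ j)    ≈⟨ toℚᵘ-homo-+ (fromℤ i) (fromℤ j) ⟨
    toℚᵘ (fromℤ i + fromℤ j)               ∎)
    where
    open ℚᵘ.≃-Reasoning
    eq : ∀ i j → (i ℤ.+ j) ℤ.* + 1 ≡ (i ℤ.* + 1 ℤ.+ j ℤ.* + 1) ℤ.* + 1
    eq = solve-∀

  fromℤ-homo-* : ∀ i j → fromℤ (i ℤ.* j) ≡ fromℤ i * fromℤ j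
  fromℤ-homo-* i j = toℚᵘ-injective (begin
    toℚᵘ (fromℤ (i ℤ.* j))                 ≈⟨ toℚᵘ-fromℤ (i ℤ.* j) ⟩
    ℚᵘ.mkℚᵘ i 0 ℚᵘ.* ℚᵘ.mkℚᵘ j 0          ≈⟨ ℚᵘ.*-cong (toℚᵘ-fromℤ i) (toℚᵘ-fromℤ j) ⟨
    toℚᵘ (fromℤ i) ℚᵘ.* toℚᵘ (fromℤ j)    ≈⟨ toℚᵘ-homo-* (fromℤ i) (fromℤ j) ⟨
    toℚᵘ (fromℤ i * fromℤ j)               ∎)
    where open ℚᵘ.≃-Reasoning

  fromℤ-homo‿- : ∀ i → fromℤ (ℤ.- i) ≡ - fromℤ i
  fromℤ-homo‿- i = toℚᵘ-injective (begin
    toℚᵘ (fromℤ (ℤ.- i))   ≈⟨ toℚᵘ-fromℤ (ℤ.- i) ⟩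
    ℚᵘ.mkℚᵘ (ℤ.- i) 0      ≈⟨ ℚᵘ.-‿cong (toℚᵘ-fromℤ i) ⟨
    ℚᵘ.- toℚᵘ (fromℤ i)    ≈⟨ toℚᵘ-homo‿- (fromℤ i) ⟨
    toℚᵘ (- fromℤ i)       ∎)
    where open ℚᵘ.≃-Reasoning

  fromℤ-homo-sub : ∀ i j → fromℤ (i ℤ.- j) ≡ fromℤ i - fromℤ j
  fromℤ-homo-sub i j = trans (fromℤ-homo-+ i (ℤ.- j)) (cong (λ x → fromℤ i + x) (fromℤ-homo‿- j))

  fromℤ-mono-≤ : ∀ {i j} → i ℤ.≤ j → fromℤ i ≤ fromℤ j
  fromℤ-mono-≤ {i} {j} i≤j = subst₂ _≤_ (sym (fromℤ≡mkℚ i)) (sym (fromℤ≡mkℚ j))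
    (*≤* (subst₂ ℤ._≤_ (sym (ℤ.*-identityʳ i)) (sym (ℤ.*-identityʳ j)) i≤j))

  fromℤ-mono-< : ∀ {i j} → i ℤ.< j → fromℤ i < fromℤ j
  fromℤ-mono-< {i} {j} i<j = subst₂ _<_ (sym (fromℤ≡mkℚ i)) (sym (fromℤ≡mkℚ j))
    (*<* (subst₂ ℤ._<_ (sym (ℤ.*-identityʳ i)) (sym (ℤ.*-identityʳ j)) i<j))

  fromℤ-floor≤ : ∀ s → fromℤ (floor s) ≤ s
  fromℤ-floor≤ s@record{} = subst (_≤ s) (sym (fromℤ≡mkℚ (floor s)))
    (*≤* (subst (floor s ℤ.* ↧ s ℤ.≤_) (sym (ℤ.*-identityʳ (↥ s))) ([n/d]*d≤n (↥ s) (↧ s))))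

  fromℤ≤⇒*↧≤↥ : ∀ {i r} → fromℤ i ≤ r → i ℤ.* ↧ r ℤ.≤ ↥ r
  fromℤ≤⇒*↧≤↥ {i} {r} i≤r with subst (_≤ r) (fromℤ≡mkℚ i) i≤r
  ... | *≤* i↧r≤↥r = subst (i ℤ.* ↧ r ℤ.≤_) (ℤ.*-identityʳ (↥ r)) i↧r≤↥r

  fromℤ[floor[i+r]-i]≤r : ∀ i r → fromℤ (floor (fromℤ i + r) ℤ.- i) ≤ r
  fromℤ[floor[i+r]-i]≤r i r = begin
    fromℤ (⌊i+r⌋ ℤ.- i)           ≡⟨ fromℤ-homo-sub ⌊i+r⌋ i ⟩
    fromℤ ⌊i+r⌋ - fromℤ i         ≤⟨ +-monoˡ-≤ (- fromℤ i) (fromℤ-floor≤ (fromℤ i + r)) ⟩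
    fromℤ i + r - fromℤ i         ≡⟨ solve 2 (λ I R → I :+ R :- I := R) refl (fromℤ i) r ⟩
    r                             ∎
    where
    open ≤-Reasoning
    open +-*-Solver
    ⌊i+r⌋ = floor (fromℤ i + r)

  floor-bound : ∀ m r L → 0ℚ < r → + L ≡ floor (fromℤ (+ m) + r) →
                L ℕ.* ↧ₙ r ℕ.≤ m ℕ.* ↧ₙ r ℕ.+ ℤ.∣ ↥ r ∣
  floor-bound m (mkℚ -[1+ _ ] _ _) L (*<* ()) _
  floor-bound m r@(mkℚ (+ p) q-1 _) L _ L≡⌊m+r⌋ = ℤ.drop‿+≤+ (begin
    + (L ℕ.* q)                           ≡⟨ ℤ.pos-* L q ⟩
    + L ℤ.* + q                           ≡⟨ eq (+ L) (+ m) (+ q) ⟩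
    (+ L ℤ.- + m) ℤ.* + q ℤ.+ + m ℤ.* + q ≤⟨ ℤ.+-monoˡ-≤ (+ m ℤ.* + q) (fromℤ≤⇒*↧≤↥ {+ L ℤ.- + m} L-m≤r) ⟩
    + p ℤ.+ + m ℤ.* + q                   ≡⟨ ℤ.+-comm (+ p) (+ m ℤ.* + q) ⟩
    + m ℤ.* + q ℤ.+ + p                   ≡⟨ cong (ℤ._+ + p) (ℤ.pos-* m q) ⟨
    + (m ℕ.* q) ℤ.+ + p                   ≡⟨ ℤ.pos-+ (m ℕ.* q) p ⟨
    + (m ℕ.* q ℕ.+ p)                     ∎)
    where
    open ℤ.≤-Reasoning
    q = suc q-1
    eq : ∀ L m q → L ℤ.* q ≡ (L ℤ.- m) ℤ.* q ℤ.+ m ℤ.* q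
    eq = solve-∀
    L-m≤r : fromℤ (+ L ℤ.- + m) ≤ r
    L-m≤r = subst (λ l → fromℤ (l ℤ.- + m) ≤ r) (sym L≡⌊m+r⌋) (fromℤ[floor[i+r]-i]≤r (+ m) r)

module RealEmbedding where

  open import Defs using (ℚ√5; ⟨_,_⟩; _⊕_; _⊗_; ⊖_; fromℚ; _^5_; Nonneg; _≤√5_; γ)
  open GoldenIntegers using (ℕ[γ]; ι; γ·_; γ^_·_; _≼_)
  open Sign using (ℤ[γ]; _⊟_; Nonneg√5; ≼⇒¬negative; ¬negative⇒nonneg√5)
  open IntegerCast
  open import Data.Nat as ℕ using (zero; suc)
  open import Data.Integer as ℤ using (+_; 0ℤ; +≤+)
  import Data.Integer.Properties as ℤ
  open import Data.Rational using (0ℚ; 1ℚ; ½; _+_; _*_; _-_; -_; _≤_; _<_)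
  open import Data.Rational.Properties
  open import Data.Rational.Solver using (module +-*-Solver)
  open import Data.Product using (_,_)
  open import Data.Sum using (inj₁; inj₂)
  open import Relation.Binary.PropositionalEquality
  open +-*-Solver using (solve; con; _:+_; _:*_; _:-_; _:=_)

  -- x + y γ = (x + y/2) + (y/2) √5, and likewise w + z γ = (2 w + z)/2 + (z/2) √5.
  ⟦_⟧ : ℕ[γ] → ℚ√5
  ⟦ x , y ⟧ = ⟨ fromℤ (+ x) + fromℤ (+ y) * ½ , fromℤ (+ y) * ½ ⟩

  ⟦_⟧ᶻ : ℤ[γ] → ℚ√5
  ⟦ w , z ⟧ᶻ = ⟨ fromℤ (+ 2 ℤ.* w ℤ.+ z) * ½ , fromℤ z * ½ ⟩

  ⟦γ·⟧ : ∀ α → ⟦ γ· α ⟧ ≡ γ ⊗ ⟦ α ⟧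
  ⟦γ·⟧ (x , y) rewrite ℤ.pos-+ x y | fromℤ-homo-+ (+ x) (+ y) = cong₂ ⟨_,_⟩
    (solve 2 (λ X Y → Y :+ (X :+ Y) :* con ½ := con ½ :* (X :+ Y :* con ½) :+ con (fromℤ (+ 5)) :* (con ½ :* (Y :* con ½))) refl (fromℤ (+ x)) (fromℤ (+ y)))
    (solve 2 (λ X Y → (X :+ Y) :* con ½ := con ½ :* (Y :* con ½) :+ con ½ :* (X :+ Y :* con ½)) refl (fromℤ (+ x)) (fromℤ (+ y)))

  fromℚ-⊗-leftComm : ∀ q x z → fromℚ q ⊗ (x ⊗ z) ≡ x ⊗ (fromℚ q ⊗ z)
  fromℚ-⊗-leftComm q ⟨ a , b ⟩ ⟨ c , d ⟩ = cong₂ ⟨_,_⟩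
    (solve 5 (λ q a b c d → q :* (a :* c :+ con (fromℤ (+ 5)) :* (b :* d)) :+ con (fromℤ (+ 5)) :* (con 0ℚ :* (a :* d :+ b :* c))
                         := a :* (q :* c :+ con (fromℤ (+ 5)) :* (con 0ℚ :* d)) :+ con (fromℤ (+ 5)) :* (b :* (q :* d :+ con 0ℚ :* c))) refl q a b c d)
    (solve 5 (λ q a b c d → q :* (a :* d :+ b :* c) :+ con 0ℚ :* (a :* c :+ con (fromℤ (+ 5)) :* (b :* d))
                         := a :* (q :* d :+ con 0ℚ :* c) :+ b :* (q :* c :+ con (fromℤ (+ 5)) :* (con 0ℚ :* d))) refl q a b c d)

  ⟦γ^·ι⟧ : ∀ k P → ⟦ γ^ k · ι P ⟧ ≡ fromℚ (fromℤ (+ P)) ⊗ (γ ^5 k)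
  ⟦γ^·ι⟧ zero P = cong₂ ⟨_,_⟩
    (solve 1 (λ p → p :+ con 0ℚ :* con ½ := p :* con 1ℚ :+ con (fromℤ (+ 5)) :* (con 0ℚ :* con 0ℚ)) refl (fromℤ (+ P)))
    (solve 1 (λ p → con 0ℚ :* con ½ := p :* con 0ℚ :+ con 0ℚ :* con 1ℚ) refl (fromℤ (+ P)))
  ⟦γ^·ι⟧ (suc k) P = begin
    ⟦ γ· γ^ k · ι P ⟧                        ≡⟨ ⟦γ·⟧ (γ^ k · ι P) ⟩
    γ ⊗ ⟦ γ^ k · ι P ⟧                       ≡⟨ cong (γ ⊗_) (⟦γ^·ι⟧ k P) ⟩
    γ ⊗ (fromℚ (fromℤ (+ P)) ⊗ (γ ^5 k))     ≡⟨ fromℚ-⊗-leftComm (fromℤ (+ P)) γ (γ ^5 k) ⟨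
    fromℚ (fromℤ (+ P)) ⊗ (γ ⊗ (γ ^5 k))     ∎
    where open ≡-Reasoning

  ⟦⟧⊖ι≡⟦⊟ι⟧ᶻ : ∀ x y c → ⟦ x , y ⟧ ⊕ (⊖ fromℚ (fromℤ (+ c))) ≡ ⟦ (x , y) ⊟ ι c ⟧ᶻ
  ⟦⟧⊖ι≡⟦⊟ι⟧ᶻ x y c = cong₂ ⟨_,_⟩ re im
    where
    X = fromℤ (+ x)
    Y = fromℤ (+ y)
    C = fromℤ (+ c)
    fromℤ-W : fromℤ (+ 2 ℤ.* (+ x ℤ.- + c) ℤ.+ (+ y ℤ.- + 0)) ≡ fromℤ (+ 2) * (X - C) + (Y - 0ℚ)
    fromℤ-W = trans (fromℤ-homo-+ (+ 2 ℤ.* (+ x ℤ.- + c)) (+ y ℤ.- + 0))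
      (cong₂ _+_ (trans (fromℤ-homo-* (+ 2) (+ x ℤ.- + c)) (cong (fromℤ (+ 2) *_) (fromℤ-homo-sub (+ x) (+ c))))
                 (fromℤ-homo-sub (+ y) (+ 0)))
    re : X + Y * ½ - C ≡ fromℤ (+ 2 ℤ.* (+ x ℤ.- + c) ℤ.+ (+ y ℤ.- + 0)) * ½
    re = trans (solve 3 (λ X Y C → X :+ Y :* con ½ :- C := (con (fromℤ (+ 2)) :* (X :- C) :+ (Y :- con 0ℚ)) :* con ½) refl X Y C)
               (cong (_* ½) (sym fromℤ-W))
    im : Y * ½ - 0ℚ ≡ fromℤ (+ y ℤ.- + 0) * ½
    im = trans (solve 1 (λ Y → Y :* con ½ :- con 0ℚ := (Y :- con 0ℚ) :* con ½) refl Y)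
               (cong (_* ½) (sym (fromℤ-homo-sub (+ y) (+ 0))))

  nonneg√5⇒nonneg : ∀ {w z} → 0ℤ ℤ.≤ z → Nonneg√5 (w , z) → Nonneg ⟦ w , z ⟧ᶻ
  nonneg√5⇒nonneg 0≤z (inj₁ 0≤W) =
    inj₁ (*-monoʳ-≤-nonNeg ½ (fromℤ-mono-≤ 0≤W) , *-monoʳ-≤-nonNeg ½ (fromℤ-mono-≤ 0≤z))
  nonneg√5⇒nonneg {w} {z} _ (inj₂ (W<0 , 0<z , W²≤5z²)) =
    inj₂ (inj₂ (*-monoˡ-<-pos ½ (fromℤ-mono-< W<0) , *-monoˡ-<-pos ½ (fromℤ-mono-< 0<z) , A²≤5B²))
    where
    W = fromℤ (+ 2 ℤ.* w ℤ.+ z)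
    Z = fromℤ z
    A²≤5B² : W * ½ * (W * ½) ≤ fromℤ (+ 5) * (Z * ½ * (Z * ½))
    A²≤5B² = begin
      W * ½ * (W * ½)                      ≡⟨ solve 1 (λ W → W :* con ½ :* (W :* con ½) := W :* W :* (con ½ :* con ½)) refl W ⟩
      W * W * (½ * ½)                      ≡⟨ cong (_* (½ * ½)) (fromℤ-homo-* (+ 2 ℤ.* w ℤ.+ z) (+ 2 ℤ.* w ℤ.+ z)) ⟨
      fromℤ ((+ 2 ℤ.* w ℤ.+ z) ℤ.* (+ 2 ℤ.* w ℤ.+ z)) * (½ * ½) ≤⟨ *-monoʳ-≤-nonNeg (½ * ½) (fromℤ-mono-≤ W²≤5z²) ⟩
      fromℤ (+ 5 ℤ.* (z ℤ.* z)) * (½ * ½)  ≡⟨ cong (_* (½ * ½)) (trans (fromℤ-homo-* (+ 5) (z ℤ.* z)) (cong (fromℤ (+ 5) *_) (fromℤ-homo-* z z))) ⟩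
      fromℤ (+ 5) * (Z * Z) * (½ * ½)      ≡⟨ solve 1 (λ Z → con (fromℤ (+ 5)) :* (Z :* Z) :* (con ½ :* con ½) := con (fromℤ (+ 5)) :* (Z :* con ½ :* (Z :* con ½))) refl Z ⟩
      fromℤ (+ 5) * (Z * ½ * (Z * ½))      ∎
      where open ≤-Reasoning

  ι≼⇒≤√5⟦⟧ : ∀ c β → ι c ≼ β → fromℚ (fromℤ (+ c)) ≤√5 ⟦ β ⟧
  ι≼⇒≤√5⟦⟧ c (x , y) ι≼β = subst Nonneg (sym (⟦⟧⊖ι≡⟦⊟ι⟧ᶻ x y c))
    (nonneg√5⇒nonneg {+ x ℤ.- + c} 0≤z (¬negative⇒nonneg√5 0≤z (≼⇒¬negative ι≼β)))
    where
    0≤z : 0ℤ ℤ.≤ + y ℤ.- + 0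
    0≤z = ℤ.i≤j⇒0≤j-i (+≤+ ℕ.z≤n)

  ι≼⇒≤√5 : ∀ c P k → ι c ≼ γ^ k · ι P → fromℚ (fromℤ (+ c)) ≤√5 (fromℚ (fromℤ (+ P)) ⊗ (γ ^5 k))
  ι≼⇒≤√5 c P k ι≼β = subst (fromℚ (fromℤ (+ c)) ≤√5_) (⟦γ^·ι⟧ k P) (ι≼⇒≤√5⟦⟧ c (γ^ k · ι P) ι≼β)

open import Defs using (IsAdditionChain; BCD; BoundedByGolden)
open GoldenIntegers
open AdditionChains using (addition-chain-bound)
open IntegerCast using (floor-bound)
open RealEmbedding using (ι≼⇒≤√5)
open import Data.Nat as ℕ using (ℕ; _+_; _*_; _^_)
open import Data.Nat.Properties using (≤-refl; +-comm; *-distribʳ-+)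
open import Data.Integer as ℤ using (+_)
open import Data.Rational as ℚ using (ℚ; 0ℚ)
open import Data.Product using (_,_)
open import Relation.Binary.PropositionalEquality using (_≡_; sym; cong; subst; trans)

lemma1 : (m : ℕ) → 4 ℕ.< m → (r : ℚ) → 0ℚ ℚ.< r →
         (n : ℕ) → 2 ℕ.^ m ℕ.≤ n → n ℕ.< 2 ℕ.^ (ℕ.suc m) →
         (L : ℕ) → + L ≡ ℚ.floor ((+ m ℚ./ 1) ℚ.+ r) →
         (a : ℕ → ℕ) → IsAdditionChain a L → a L ≡ n →
         BoundedByGolden (BCD a L) r
lemma1 m _ r 0<r n 2^m≤n _ L L≡⌊m+r⌋ a chain aL≡n =
  ι≼⇒≤√5 (2 ^ (N * q)) (2 ^ p) (N * q) (monomial-cancelˡ-≼ (m * q) {N * q} {0} {p} {N * q} (begin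
    2^ (m * q + N * q) ·γ^ 0      ≡⟨ cong (2^_·γ^ 0) (trans (*-distribʳ-+ q N m) (+-comm (N * q) (m * q))) ⟨
    2^ ((N + m) * q) ·γ^ (0 * q)  ≲⟨ monomial-pow-≼ q {N + m} {0} {L} {N} 2^[N+m]≼2^Lγ^N ⟩
    2^ (L * q) ·γ^ (N * q)        ≲⟨ monomial-mono-≼ (N * q) (floor-bound m r L 0<r L≡⌊m+r⌋) ⟩
    2^ (m * q + p) ·γ^ (N * q)    ∎))
  where
  open ≼-Reasoning
  N = BCD a L
  q = ℚ.↧ₙ r
  p = ℤ.∣ ℚ.↥ r ∣
  2^[N+m]≼2^Lγ^N : 2^ (N + m) ·γ^ 0 ≼ 2^ L ·γ^ N
  2^[N+m]≼2^Lγ^N = begin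
    2^ (N + m) ·γ^ 0       ≡⟨ monomial-⊠ N 0 m 0 ⟨
    ι (2 ^ N) ⊠ ι (2 ^ m)  ≲⟨ ⊠-monoʳ-≼ (ι (2 ^ N)) (≤ᶜ⇒≼ (subst (2 ^ m ℕ.≤_) (sym aL≡n) 2^m≤n , ≤-refl)) ⟩
    ι (2 ^ N) ⊠ ι (a L)    ≲⟨ addition-chain-bound chain ⟩
    2^ L ·γ^ N             ∎
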